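{- The data $\mathbb{T}$ described in the context — objects are finite lists of target types, morphisms $X \to Y$ are equivalence classes of well-typed target programs $P\colon X\to Y$ modulo program equality, identities and composition as defined below — form a category (in particular, composition is well defined on equivalence classes, associative, and unital).
   Context: Target types: $A,B ::= \alpha \mid \mathtt{unit} \mid \mathtt{nat} \mid A\times B \mid A+B \mid \mu\alpha.A$. Target expressions are the usual terms for these types: variables, $<>$, numerals $n$, $e_1+e_2$, $\mathtt{iszero}(e)$ (of type $\mathtt{unit}+\mathtt{unit}$, $\mathtt{inl}(<>)$ meaning true), pairs $<e_1,e_2>$, $\mathtt{let}\ e_1\ \mathtt{be}\ <x,y>\ \mathtt{in}\ e_2$, $\mathtt{inl}(e)$, $\mathtt{inr}(e)$, $\mathtt{case}\ e\ \mathtt{of}\ \mathtt{inl}(x)\Rightarrow e_1 \mid \mathtt{inr}(y)\Rightarrow e_2$, $\mathtt{fold}_A(e)$, $\mathtt{unfold}_A(e)$, with the standard simple typing rules and the standard call-by-value small-step reduction $\longrightarrow$; values are $v ::= <> \mid n \mid <v,w> \mid \mathtt{inl}(v)\mid \mathtt{inr}(v)\mid \mathtt{fold}_A(v)$. Every closed well-typed expression reduces to a unique value. Fix an infinite set $\mathcal{L}$ of function labels. A function definition for $f\in\mathcal{L}$ is an equation $f(x)=g(e)$ or $f(x)=\mathtt{case}\ e\ \mathtt{of}\ \mathtt{inl}(y)\Rightarrow g(e_1)\mid \mathtt{inr}(z)\Rightarrow h(e_2)$ with $g,h\in\mathcal{L}$ and target expressions $e,e_1,e_2$. A target program $P=(i,D,o)$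 consists of a set $D$ of function definitions, a list $i\in\mathcal{L}^*$ of entry labels and a list $o\in\mathcal{L}^*$ of exit labels; $i$ and $o$ each consist of pairwise distinct labels, $D$ contains at most one definition per label and no definition for any label in $o$. $P$ is well typed if each label $f$ can be assigned an argument type $A(f)$ such that each definition type-checks ($x:A(f)\vdash e:A(g)$ for $f(x)=g(e)$; for the case form, $x:A(f)\vdash e:C_1+C_2$, $y:C_1\vdash e_1:A(g)$, $z:C_2\vdash e_2:A(h)$ for some $C_1,C_2$). If $i=f_1\dots f_n$ and $o=g_1\dots g_m$, we write $P\colon (A_1\dots A_n)\to(B_1\dots B_m)$ where $A_j=A(f_j)$, $B_j=A(g_j)$. Execution: $f(v)\longrightarrow_P g(w)$ if $P$ has $f(x)=g(e)$ and $e[v/x]\longrightarrow^* w$; or $P$ has the case form and either $e[v/x]\longrightarrow^*\mathtt{inl}(u)$ and $e_1[u/y]\longrightarrow^* w$ (jump to $g$) or $e[v/x]\longrightarrow^*\mathtt{inr}(u)$ and $e_2[u/z]\longrightarrow^* w$ (jump to $h$). A call-trace of $P$ is a sequence $f_1(v_1)\dots f_n(v_n)$ of labels applied to values with $f_k(v_k)\longrightarrow_P f_{k+1}(v_{k+1})$ for all $k<n$ (a single call $f(v)$ is a trace of length one). Program equality: $P,Q\colon (A_1\dots A_n)\to(B_1\dots B_m)$ with entry labels $f_1..f_n$ resp. $g_1..g_n$ and exit labels $h_1..h_m$ resp. $k_1..k_m$ are equal if for all values $v,w$ and indices $i,j$: $P$ has a call-trace of the form $f_i(v)\dots h_j(w)$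 iff $Q$ has a call-trace of the form $g_i(v)\dots k_j(w)$. Identity on $X=A_1\dots A_n$: the program $(f_1\dots f_n,\emptyset,f_1\dots f_n)$. Composition of $P\colon X\to Y$ and $Q\colon Y\to Z$: rename labels so that $P=(i,D_P,m)$ and $Q=(m,D_Q,o)$ with all other labels of $P$ and $Q$ disjoint; then $Q\circ P=(i,D_P\cup D_Q,o)$. -}

module Defs where

open import Data.Nat using (ℕ; zero; suc; _+_)
open import Data.Fin using (Fin; zero; suc)
open import Data.Vec using (Vec; []; _∷_; lookup)
open import Data.List using (List; []; _∷_; map; _++_; concatMap; upTo; length)
open import Data.List.Membership.Propositional using (_∈_; _∉_)
open import Data.List.Relation.Unary.Unique.Propositional using (Unique)
open import Data.Product using (Σ; Σ-syntax; _×_; _,_; proj₁; proj₂)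
open import Function.Definitions using (Injective)
open import Relation.Binary.PropositionalEquality using (_≡_)
open import Relation.Binary.Construct.Closure.ReflexiveTransitive using (Star)

-- Target types  A ::= α | unit | nat | A × B | A + B | μα.A
-- (de Bruijn type variables; Ty n = types with n free type variables)

data Ty (n : ℕ) : Set where
  tvar : Fin n → Ty n
  unit : Ty n
  nat  : Ty n
  _⊗_  : Ty n → Ty n → Ty n
  _⊕_  : Ty n → Ty n → Ty n
  μ    : Ty (suc n) → Ty n

textR : ∀ {m n} → (Fin m → Fin n) → Fin (suc m) → Fin (suc n)
textR ρ zero    = zero
textR ρ (suc i) = suc (ρ i)

tren : ∀ {m n} → (Fin m → Fin n) → Ty m → Ty n
tren ρ (tvar i) = tvar (ρ i)
tren ρ unit     = unit
tren ρ nat      = nat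
tren ρ (A ⊗ B)  = tren ρ A ⊗ tren ρ B
tren ρ (A ⊕ B)  = tren ρ A ⊕ tren ρ B
tren ρ (μ A)    = μ (tren (textR ρ) A)

textS : ∀ {m n} → (Fin m → Ty n) → Fin (suc m) → Ty (suc n)
textS σ zero    = tvar zero
textS σ (suc i) = tren suc (σ i)

tsub : ∀ {m n} → (Fin m → Ty n) → Ty m → Ty n
tsub σ (tvar i) = σ i
tsub σ unit     = unit
tsub σ nat      = nat
tsub σ (A ⊗ B)  = tsub σ A ⊗ tsub σ B
tsub σ (A ⊕ B)  = tsub σ A ⊕ tsub σ B
tsub σ (μ A)    = μ (tsub (textS σ) A)

_[_]ᵗ : ∀ {n} → Ty (suc n) → Ty n → Ty n
A [ B ]ᵗ = tsub (λ { zero → B ; (suc i) → tvar i }) A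

-- Target expressions (de Bruijn term variables; Exp n has n free vars)
-- letp e₁ e₂ : let e₁ be <x,y> in e₂, where in e₂ var 0 = y, var 1 = x.
-- case e e₁ e₂ : in e₁ / e₂ the bound variable is var 0.

data Exp (n : ℕ) : Set where
  var    : Fin n → Exp n
  ⟨⟩     : Exp n
  num    : ℕ → Exp n
  _⊞_    : Exp n → Exp n → Exp n
  iszero : Exp n → Exp n
  pair   : Exp n → Exp n → Exp n
  letp   : Exp n → Exp (suc (suc n)) → Exp n
  inl    : Exp n → Exp n
  inr    : Exp n → Exp n
  case   : Exp n → Exp (suc n) → Exp (suc n) → Exp n
  fold   : Ty 0 → Exp n → Exp n
  unfold : Ty 0 → Exp n → Exp n

extR : ∀ {m n} → (Fin m → Fin n) → Fin (suc m) → Fin (suc n)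
extR ρ zero    = zero
extR ρ (suc i) = suc (ρ i)

ren : ∀ {m n} → (Fin m → Fin n) → Exp m → Exp n
ren ρ (var i)        = var (ρ i)
ren ρ ⟨⟩             = ⟨⟩
ren ρ (num k)        = num k
ren ρ (e₁ ⊞ e₂)      = ren ρ e₁ ⊞ ren ρ e₂
ren ρ (iszero e)     = iszero (ren ρ e)
ren ρ (pair e₁ e₂)   = pair (ren ρ e₁) (ren ρ e₂)
ren ρ (letp e₁ e₂)   = letp (ren ρ e₁) (ren (extR (extR ρ)) e₂)
ren ρ (inl e)        = inl (ren ρ e)
ren ρ (inr e)        = inr (ren ρ e)
ren ρ (case e e₁ e₂) = case (ren ρ e) (ren (extR ρ) e₁) (ren (extR ρ) e₂)
ren ρ (fold A e)     = fold A (ren ρ e)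
ren ρ (unfold A e)   = unfold A (ren ρ e)

extS : ∀ {m n} → (Fin m → Exp n) → Fin (suc m) → Exp (suc n)
extS σ zero    = var zero
extS σ (suc i) = ren suc (σ i)

sub : ∀ {m n} → (Fin m → Exp n) → Exp m → Exp n
sub σ (var i)        = σ i
sub σ ⟨⟩             = ⟨⟩
sub σ (num k)        = num k
sub σ (e₁ ⊞ e₂)      = sub σ e₁ ⊞ sub σ e₂
sub σ (iszero e)     = iszero (sub σ e)
sub σ (pair e₁ e₂)   = pair (sub σ e₁) (sub σ e₂)
sub σ (letp e₁ e₂)   = letp (sub σ e₁) (sub (extS (extS σ)) e₂)
sub σ (inl e)        = inl (sub σ e)
sub σ (inr e)        = inr (sub σ e)
sub σ (case e e₁ e₂) = case (sub σ e) (sub (extS σ) e₁) (sub (extS σ) e₂)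
sub σ (fold A e)     = fold A (sub σ e)
sub σ (unfold A e)   = unfold A (sub σ e)

_[_] : Exp 1 → Exp 0 → Exp 0
e [ v ] = sub (λ { zero → v }) e

_[_,_]₂ : Exp 2 → Exp 0 → Exp 0 → Exp 0
e [ v , w ]₂ = sub (λ { zero → w ; (suc zero) → v }) e

Ctx : ℕ → Set
Ctx n = Vec (Ty 0) n

infix 4 _⊢_∶_
data _⊢_∶_ {n : ℕ} (Γ : Ctx n) : Exp n → Ty 0 → Set where
  ty-var    : ∀ i → Γ ⊢ var i ∶ lookup Γ i
  ty-unit   : Γ ⊢ ⟨⟩ ∶ unit
  ty-num    : ∀ k → Γ ⊢ num k ∶ nat
  ty-plus   : ∀ {e₁ e₂} → Γ ⊢ e₁ ∶ nat → Γ ⊢ e₂ ∶ nat → Γ ⊢ e₁ ⊞ e₂ ∶ nat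
  ty-iszero : ∀ {e} → Γ ⊢ e ∶ nat → Γ ⊢ iszero e ∶ (unit ⊕ unit)
  ty-pair   : ∀ {e₁ e₂ A B} → Γ ⊢ e₁ ∶ A → Γ ⊢ e₂ ∶ B → Γ ⊢ pair e₁ e₂ ∶ (A ⊗ B)
  ty-letp   : ∀ {e₁ e₂ A B C} → Γ ⊢ e₁ ∶ (A ⊗ B) → (B ∷ A ∷ Γ) ⊢ e₂ ∶ C
            → Γ ⊢ letp e₁ e₂ ∶ C
  ty-inl    : ∀ {e A B} → Γ ⊢ e ∶ A → Γ ⊢ inl e ∶ (A ⊕ B)
  ty-inr    : ∀ {e A B} → Γ ⊢ e ∶ B → Γ ⊢ inr e ∶ (A ⊕ B)
  ty-case   : ∀ {e e₁ e₂ A B C} → Γ ⊢ e ∶ (A ⊕ B)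
            → (A ∷ Γ) ⊢ e₁ ∶ C → (B ∷ Γ) ⊢ e₂ ∶ C → Γ ⊢ case e e₁ e₂ ∶ C
  ty-fold   : ∀ {e} {A : Ty 1} → Γ ⊢ e ∶ (A [ μ A ]ᵗ) → Γ ⊢ fold (μ A) e ∶ μ A
  ty-unfold : ∀ {e} {A : Ty 1} → Γ ⊢ e ∶ μ A → Γ ⊢ unfold (μ A) e ∶ (A [ μ A ]ᵗ)

data Value : Exp 0 → Set where
  v-unit : Value ⟨⟩
  v-num  : ∀ k → Value (num k)
  v-pair : ∀ {v w} → Value v → Value w → Value (pair v w)
  v-inl  : ∀ {v} → Value v → Value (inl v)
  v-inr  : ∀ {v} → Value v → Value (inr v)
  v-fold : ∀ {A v} → Value v → Value (fold A v)

infix 4 _⟶_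
data _⟶_ : Exp 0 → Exp 0 → Set where
  ξ-plusˡ  : ∀ {e₁ e₁' e₂} → e₁ ⟶ e₁' → e₁ ⊞ e₂ ⟶ e₁' ⊞ e₂
  ξ-plusʳ  : ∀ {v e₂ e₂'} → Value v → e₂ ⟶ e₂' → v ⊞ e₂ ⟶ v ⊞ e₂'
  β-plus   : ∀ {m n} → num m ⊞ num n ⟶ num (m + n)
  ξ-iszero : ∀ {e e'} → e ⟶ e' → iszero e ⟶ iszero e'
  β-iszero₀ : iszero (num 0) ⟶ inl ⟨⟩
  β-iszeroₛ : ∀ {n} → iszero (num (suc n)) ⟶ inr ⟨⟩
  ξ-pairˡ  : ∀ {e₁ e₁' e₂} → e₁ ⟶ e₁' → pair e₁ e₂ ⟶ pair e₁' e₂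
  ξ-pairʳ  : ∀ {v e₂ e₂'} → Value v → e₂ ⟶ e₂' → pair v e₂ ⟶ pair v e₂'
  ξ-letp   : ∀ {e₁ e₁' e₂} → e₁ ⟶ e₁' → letp e₁ e₂ ⟶ letp e₁' e₂
  β-letp   : ∀ {v w e} → Value v → Value w → letp (pair v w) e ⟶ e [ v , w ]₂
  ξ-inl    : ∀ {e e'} → e ⟶ e' → inl e ⟶ inl e'
  ξ-inr    : ∀ {e e'} → e ⟶ e' → inr e ⟶ inr e'
  ξ-case   : ∀ {e e' e₁ e₂} → e ⟶ e' → case e e₁ e₂ ⟶ case e' e₁ e₂
  β-inl    : ∀ {v e₁ e₂} → Value v → case (inl v) e₁ e₂ ⟶ e₁ [ v ]
  β-inr    : ∀ {v e₁ e₂} → Value v → case (inr v) e₁ e₂ ⟶ e₂ [ v ]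
  ξ-fold   : ∀ {A e e'} → e ⟶ e' → fold A e ⟶ fold A e'
  ξ-unfold : ∀ {A e e'} → e ⟶ e' → unfold A e ⟶ unfold A e'
  β-unfold : ∀ {A B v} → Value v → unfold A (fold B v) ⟶ v

infix 4 _⟶*_
_⟶*_ : Exp 0 → Exp 0 → Set
_⟶*_ = Star _⟶_

-- Target programs.  Function labels: ℒ = ℕ (an infinite set).

Label : Set
Label = ℕ

-- right-hand sides of definitions  f(x) = ...
--   jump g e            :  g(e)                  (x = var 0 in e)
--   branch e g e₁ h e₂  :  case e of inl(y) ⇒ g(e₁) | inr(z) ⇒ h(e₂)
--                          (x = var 0 in e; y resp. z = var 0 in e₁ resp. e₂)
data Def : Set where
  jump   : Label → Exp 1 → Def
  branch : Exp 1 → Label → Exp 1 → Label → Exp 1 → Def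

record Program : Set where
  constructor prog
  field
    entries : List Label
    defs    : List (Label × Def)
    exits   : List Label
open Program public

defined : Program → List Label
defined P = map proj₁ (defs P)

record WF (P : Program) : Set where
  field
    entries-unique : Unique (entries P)
    exits-unique   : Unique (exits P)
    defs-unique    : Unique (defined P)
    exits-undef    : ∀ l → l ∈ exits P → l ∉ defined P

DefOK : (Label → Ty 0) → Label → Def → Set
DefOK A f (jump g e) = (A f ∷ []) ⊢ e ∶ A g
DefOK A f (branch e g e₁ h e₂) =
  Σ[ C₁ ∈ Ty 0 ] Σ[ C₂ ∈ Ty 0 ]
    ((A f ∷ []) ⊢ e ∶ (C₁ ⊕ C₂)) × ((C₁ ∷ []) ⊢ e₁ ∶ A g) × ((C₂ ∷ []) ⊢ e₂ ∶ A h)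

infix 4 _∶_⇒_
_∶_⇒_ : Program → List (Ty 0) → List (Ty 0) → Set
P ∶ X ⇒ Y = WF P × Σ[ A ∈ (Label → Ty 0) ]
    ((∀ f d → (f , d) ∈ defs P → DefOK A f d)
     × map A (entries P) ≡ X × map A (exits P) ≡ Y)

data Step (P : Program) : Label × Exp 0 → Label × Exp 0 → Set where
  step-jump : ∀ {f g e v w} → (f , jump g e) ∈ defs P
            → e [ v ] ⟶* w → Value w → Step P (f , v) (g , w)
  step-inl  : ∀ {f g h e e₁ e₂ v u w} → (f , branch e g e₁ h e₂) ∈ defs P
            → e [ v ] ⟶* inl u → e₁ [ u ] ⟶* w → Value w → Step P (f , v) (g , w)
  step-inr  : ∀ {f g h e e₁ e₂ v u w} → (f , branch e g e₁ h e₂) ∈ defs P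
            → e [ v ] ⟶* inr u → e₂ [ u ] ⟶* w → Value w → Step P (f , v) (h , w)

data At {A : Set} : List A → ℕ → A → Set where
  here  : ∀ {x xs} → At (x ∷ xs) zero x
  there : ∀ {x y xs i} → At xs i y → At (x ∷ xs) (suc i) y

Trace : Program → ℕ → Exp 0 → ℕ → Exp 0 → Set
Trace P i v j w = Σ[ f ∈ Label ] Σ[ h ∈ Label ]
  (At (entries P) i f × At (exits P) j h × Value v × Value w
   × Star (Step P) (f , v) (h , w))

infix 4 _≈P_
_≈P_ : Program → Program → Set
P ≈P Q = ∀ i v j w → (Trace P i v j w → Trace Q i v j w) × (Trace Q i v j w → Trace P i v j w)

idP : List (Ty 0) → Program
idP X = prog (upTo (length X)) [] (upTo (length X))

renDef : (Label → Label) → Def → Def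
renDef ρ (jump g e)           = jump (ρ g) e
renDef ρ (branch e g e₁ h e₂) = branch e (ρ g) e₁ (ρ h) e₂

rename : (Label → Label) → Program → Program
rename ρ P = prog (map ρ (entries P))
                  (map (λ fd → ρ (proj₁ fd) , renDef ρ (proj₂ fd)) (defs P))
                  (map ρ (exits P))

targets : Def → List Label
targets (jump g e)           = g ∷ []
targets (branch e g e₁ h e₂) = g ∷ h ∷ []

labels : Program → List Label
labels P = entries P ++ exits P ++ defined P ++ concatMap (λ fd → targets (proj₂ fd)) (defs P)

-- Composite P Q R : R is a composition Q ∘ P, i.e. obtained by renaming
-- labels (injectively) so that P = (i, D_P, m), Q = (m, D_Q, o) with all
-- other labels disjoint, and R = (i, D_P ∪ D_Q, o).
Composite : Program → Program → Program → Set
Composite P Q R = Σ[ ρ ∈ (Label → Label) ] Σ[ σ ∈ (Label → Label) ]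
  (Injective _≡_ _≡_ ρ × Injective _≡_ _≡_ σ
   × exits (rename ρ P) ≡ entries (rename σ Q)
   × (∀ l → l ∈ labels (rename ρ P) → l ∈ labels (rename σ Q) → l ∈ exits (rename ρ P))
   × R ≡ prog (entries (rename ρ P)) (defs (rename ρ P) ++ defs (rename σ Q)) (exits (rename σ Q)))

record TIsCategory : Set where
  field
    ≈-refl  : ∀ {P} → P ≈P P
    ≈-sym   : ∀ {P Q} → P ≈P Q → Q ≈P P
    ≈-trans : ∀ {P Q R} → P ≈P Q → Q ≈P R → P ≈P R
    id-typed : ∀ X → idP X ∶ X ⇒ X
    comp-exists : ∀ {X Y Z P Q} → P ∶ X ⇒ Y → Q ∶ Y ⇒ Z → Σ[ R ∈ Program ] Composite P Q R
    comp-typed  : ∀ {X Y Z P Q R} → P ∶ X ⇒ Y → Q ∶ Y ⇒ Z → Composite P Q R → R ∶ X ⇒ Z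
    -- composition is well defined on equivalence classes
    -- (independent of the representatives and of the chosen renaming)
    comp-cong : ∀ {X Y Z P P' Q Q' R R'}
      → P ∶ X ⇒ Y → P' ∶ X ⇒ Y → Q ∶ Y ⇒ Z → Q' ∶ Y ⇒ Z
      → P ≈P P' → Q ≈P Q' → Composite P Q R → Composite P' Q' R' → R ≈P R'
    identityˡ : ∀ {X Y P R} → P ∶ X ⇒ Y → Composite P (idP Y) R → R ≈P P
    identityʳ : ∀ {X Y P R} → P ∶ X ⇒ Y → Composite (idP X) P R → R ≈P P
    assoc : ∀ {W X Y Z P Q S PQ QS A B}
      → P ∶ W ⇒ X → Q ∶ X ⇒ Y → S ∶ Y ⇒ Z
      → Composite P Q PQ → Composite PQ S A
      → Composite Q S QS → Composite P QS B
      → A ≈P B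

module Submission where

-- Everything rests on one semantic fact, composite-traces: if R is a
-- composite of P and Q, then R has a call-trace from its i-th entry to its
-- j-th exit exactly when P has a call-trace from its i-th entry to some
-- exit l that is followed by a call-trace of Q from its l-th entry.  It is
-- proved in two layers:
--   * Relabel: an injective relabelling does not change the traces;
--   * Glue: the only labels shared by the renamed P and Q are P's exits,
--     which P does not define, so a run of the glued definitions first
--     runs inside P until it reaches an exit and then runs inside Q.
-- Congruence, the unit laws and associativity then only rearrange the
-- intermediate witnesses.  The remaining, syntactic, obligations are that
-- identities and composites are well typed (the type of a relabelled label
-- is read back through a partial inverse of the renaming) and that
-- composites exist (two renamings built from a three-way partition of ℕ).

open import Defs
open import Data.Nat using (ℕ; zero; suc; _<_; z≤n; s≤s)
open import Data.Nat.Properties using (_≟_; suc-injective)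
open import Data.Vec using ([]; _∷_)
open import Data.List using (List; []; _∷_; map; _++_; concatMap; upTo; applyUpTo; length)
open import Data.List.Properties using (map-++; map-∘; length-map; map-cong-local; map-applyUpTo)
open import Data.List.Membership.Propositional using (_∈_; _∉_)
open import Data.List.Membership.Propositional.Properties using (∈-map⁺; ∈-map⁻; ∈-++⁺ˡ; ∈-++⁺ʳ; ∈-++⁻)
open import Data.List.Membership.DecPropositional _≟_ using (_∈?_)
open import Data.List.Relation.Unary.Any using (here; there)
open import Data.List.Relation.Unary.AllPairs using ([]; _∷_)
open import Data.List.Relation.Unary.Unique.Propositional using (Unique)
import Data.List.Relation.Unary.All as All
import Data.List.Relation.Unary.Unique.Propositional.Properties as Unique
open import Data.Product using (Σ-syntax; ∃; _×_; _,_; proj₁; proj₂; map₁)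
open import Data.Sum using (_⊎_; inj₁; inj₂)
open import Data.Empty using (⊥; ⊥-elim)
open import Function using (_∘_; id)
open import Function.Bundles using (_⇔_; mk⇔; Equivalence)
open import Function.Definitions using (Injective)
open import Relation.Nullary using (Dec; yes; no)
open import Relation.Binary.PropositionalEquality using (_≡_; _≢_; refl; sym; trans; cong; cong₂; subst; subst₂; module ≡-Reasoning)
open import Relation.Binary.Construct.Closure.ReflexiveTransitive using (Star; ε; _◅_; _◅◅_; gmap)
import Relation.Binary.Construct.Closure.ReflexiveTransitive as Star

open Equivalence using (to; from)

At⇒∈ : ∀ {A : Set} {xs : List A} {i x} → At xs i x → x ∈ xs
At⇒∈ here      = here refl
At⇒∈ (there a) = there (At⇒∈ a)

∈⇒At : ∀ {A : Set} {xs : List A} {x} → x ∈ xs → ∃ λ i → At xs i x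
∈⇒At (here refl) = zero , here
∈⇒At (there x∈) with ∈⇒At x∈
... | i , a = suc i , there a

At-functional : ∀ {A : Set} {xs : List A} {i x y} → At xs i x → At xs i y → x ≡ y
At-functional here      here      = refl
At-functional (there a) (there b) = At-functional a b

At-position-unique : ∀ {A : Set} {xs : List A} {i k x} → Unique xs → At xs i x → At xs k x → i ≡ k
At-position-unique _        here      here      = refl
At-position-unique (x∉ ∷ _) here      (there b) = ⊥-elim (All.lookup x∉ (At⇒∈ b) refl)
At-position-unique (x∉ ∷ _) (there a) here      = ⊥-elim (All.lookup x∉ (At⇒∈ a) refl)
At-position-unique (_ ∷ u)  (there a) (there b) = cong suc (At-position-unique u a b)

At-map⁺ : ∀ {A B : Set} (f : A → B) {xs i x} → At xs i x → At (map f xs) i (f x)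
At-map⁺ f here      = here
At-map⁺ f (there a) = there (At-map⁺ f a)

At-map⁻ : ∀ {A B : Set} (f : A → B) {xs i y} → At (map f xs) i y → ∃ λ x → At xs i x × f x ≡ y
At-map⁻ f {_ ∷ _} here      = _ , here , refl
At-map⁻ f {_ ∷ _} (there a) with At-map⁻ f a
... | x , b , fx≡y = x , there b , fx≡y

At-bound : ∀ {A : Set} {xs : List A} {i x} → At xs i x → i < length xs
At-bound here      = s≤s z≤n
At-bound (there a) = s≤s (At-bound a)

At-applyUpTo⁻ : ∀ {A : Set} (g : ℕ → A) n {i x} → At (applyUpTo g n) i x → x ≡ g i
At-applyUpTo⁻ g (suc n) here      = refl
At-applyUpTo⁻ g (suc n) (there a) = At-applyUpTo⁻ (g ∘ suc) n a

At-applyUpTo⁺ : ∀ {A : Set} (g : ℕ → A) n {i} → i < n → At (applyUpTo g n) i (g i)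
At-applyUpTo⁺ g (suc n) {zero}  _       = here
At-applyUpTo⁺ g (suc n) {suc i} (s≤s p) = there (At-applyUpTo⁺ (g ∘ suc) n p)

map-by-position : ∀ {A B : Set} (f : A → B) (h : ℕ → B) (xs : List A)
                → (∀ k x → At xs k x → f x ≡ h k) → map f xs ≡ applyUpTo h (length xs)
map-by-position f h []       _ = refl
map-by-position f h (x ∷ xs) p =
  cong₂ _∷_ (p 0 x here) (map-by-position f (h ∘ suc) xs (λ k y a → p (suc k) y (there a)))

entry∈labels : ∀ P {f} → f ∈ entries P → f ∈ labels P
entry∈labels P = ∈-++⁺ˡ

exit∈labels : ∀ P {f} → f ∈ exits P → f ∈ labels P
exit∈labels P = ∈-++⁺ʳ (entries P) ∘ ∈-++⁺ˡ

defined∈labels : ∀ P {f} → f ∈ defined P → f ∈ labels P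
defined∈labels P = ∈-++⁺ʳ (entries P) ∘ ∈-++⁺ʳ (exits P) ∘ ∈-++⁺ˡ

target∈targets : ∀ {D : List (Label × Def)} {f d g} → (f , d) ∈ D → g ∈ targets d
               → g ∈ concatMap (targets ∘ proj₂) D
target∈targets {(_ , d) ∷ _} (here refl) g∈ = ∈-++⁺ˡ g∈
target∈targets {(_ , d) ∷ _} (there fd∈) g∈ = ∈-++⁺ʳ (targets d) (target∈targets fd∈ g∈)

target∈labels : ∀ P {f d g} → (f , d) ∈ defs P → g ∈ targets d → g ∈ labels P
target∈labels P fd∈ g∈ =
  ∈-++⁺ʳ (entries P) (∈-++⁺ʳ (exits P) (∈-++⁺ʳ (defined P) (target∈targets fd∈ g∈)))

ExitsUndefined : Program → Set
ExitsUndefined P = ∀ l → l ∈ exits P → l ∉ defined P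

step-source : ∀ {P a b} → Step P a b → proj₁ a ∈ defined P
step-source (step-jump fd∈ _ _)   = ∈-map⁺ proj₁ fd∈
step-source (step-inl fd∈ _ _ _)  = ∈-map⁺ proj₁ fd∈
step-source (step-inr fd∈ _ _ _)  = ∈-map⁺ proj₁ fd∈

step-target : ∀ {P a b} → Step P a b → proj₁ b ∈ labels P
step-target {P} (step-jump fd∈ _ _)  = target∈labels P fd∈ (here refl)
step-target {P} (step-inl fd∈ _ _ _) = target∈labels P fd∈ (here refl)
step-target {P} (step-inr fd∈ _ _ _) = target∈labels P fd∈ (there (here refl))

step-value : ∀ {P a b} → Step P a b → Value (proj₂ b)
step-value (step-jump _ _ w)  = w
step-value (step-inl _ _ _ w) = w
step-value (step-inr _ _ _ w) = w

step-mono : ∀ {P Q} → (∀ {fd} → fd ∈ defs P → fd ∈ defs Q) → ∀ {a b} → Step P a b → Step Q a b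
step-mono P⊆Q (step-jump fd∈ r w)    = step-jump (P⊆Q fd∈) r w
step-mono P⊆Q (step-inl fd∈ r r₁ w)  = step-inl (P⊆Q fd∈) r r₁ w
step-mono P⊆Q (step-inr fd∈ r r₂ w)  = step-inr (P⊆Q fd∈) r r₂ w

SeqTrace : Program → Program → ℕ → Exp 0 → ℕ → Exp 0 → Set
SeqTrace P Q i v j w = Σ[ l ∈ ℕ ] Σ[ u ∈ Exp 0 ] Trace P i v l u × Trace Q l u j w

SeqTrace-map : ∀ {P P′ Q Q′}
             → (∀ {i v j w} → Trace P i v j w → Trace P′ i v j w)
             → (∀ {i v j w} → Trace Q i v j w → Trace Q′ i v j w)
             → ∀ {i v j w} → SeqTrace P Q i v j w → SeqTrace P′ Q′ i v j w
SeqTrace-map onP onQ (l , u , tP , tQ) = l , u , onP tP , onQ tQ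

trace-entry-bound : ∀ {P i v j w} → Trace P i v j w → i < length (entries P)
trace-entry-bound (_ , _ , atᵢ , _) = At-bound atᵢ

trace-exit-bound : ∀ {P i v j w} → Trace P i v j w → j < length (exits P)
trace-exit-bound (_ , _ , _ , atⱼ , _) = At-bound atⱼ

trace-values : ∀ {P i v j w} → Trace P i v j w → Value v × Value w
trace-values (_ , _ , _ , _ , v , w , _) = v , w

module Relabel (ρ : Label → Label) (ρ-inj : Injective _≡_ _≡_ ρ) (P : Program) where

  relabelDef : Label × Def → Label × Def
  relabelDef fd = ρ (proj₁ fd) , renDef ρ (proj₂ fd)

  step-relabel : ∀ {a b} → Step P a b → Step (rename ρ P) (map₁ ρ a) (map₁ ρ b)
  step-relabel (step-jump fd∈ r w)   = step-jump (∈-map⁺ relabelDef fd∈) r w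
  step-relabel (step-inl fd∈ r r₁ w) = step-inl (∈-map⁺ relabelDef fd∈) r r₁ w
  step-relabel (step-inr fd∈ r r₂ w) = step-inr (∈-map⁺ relabelDef fd∈) r r₂ w

  step-unrelabel : ∀ {a b} → Step (rename ρ P) a b → ∀ f → proj₁ a ≡ ρ f
                 → ∃ λ g → ρ g ≡ proj₁ b × Step P (f , proj₂ a) (g , proj₂ b)
  step-unrelabel (step-jump fd∈ r w) f eq with ∈-map⁻ relabelDef fd∈
  ... | (f₀ , jump g e) , fd₀∈ , refl with ρ-inj eq
  ... | refl = g , refl , step-jump fd₀∈ r w
  step-unrelabel (step-inl fd∈ r r₁ w) f eq with ∈-map⁻ relabelDef fd∈
  ... | (f₀ , branch e g e₁ h e₂) , fd₀∈ , refl with ρ-inj eq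
  ... | refl = g , refl , step-inl fd₀∈ r r₁ w
  step-unrelabel (step-inr fd∈ r r₂ w) f eq with ∈-map⁻ relabelDef fd∈
  ... | (f₀ , branch e g e₁ h e₂) , fd₀∈ , refl with ρ-inj eq
  ... | refl = h , refl , step-inr fd₀∈ r r₂ w

  run-unrelabel : ∀ {a b} → Star (Step (rename ρ P)) a b → ∀ f → proj₁ a ≡ ρ f
                → ∃ λ h → ρ h ≡ proj₁ b × Star (Step P) (f , proj₂ a) (h , proj₂ b)
  run-unrelabel ε        f eq = f , sym eq , ε
  run-unrelabel (s ◅ ss) f eq with step-unrelabel s f eq
  ... | g , ρg≡ , s′ with run-unrelabel ss g (sym ρg≡)
  ... | h , ρh≡ , ss′ = h , ρh≡ , s′ ◅ ss′

  traces : ∀ {i v j w} → Trace (rename ρ P) i v j w ⇔ Trace P i v j w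
  traces = mk⇔ unrelabel relabel
    where
    relabel : ∀ {i v j w} → Trace P i v j w → Trace (rename ρ P) i v j w
    relabel (f , h , atᵢ , atⱼ , v , w , run) =
      ρ f , ρ h , At-map⁺ ρ atᵢ , At-map⁺ ρ atⱼ , v , w , gmap (map₁ ρ) step-relabel run

    unrelabel : ∀ {i v j w} → Trace (rename ρ P) i v j w → Trace P i v j w
    unrelabel (_ , _ , atᵢ , atⱼ , v , w , run) with At-map⁻ ρ atᵢ | At-map⁻ ρ atⱼ
    ... | f , atᵢ′ , refl | _ , atⱼ′ , refl with run-unrelabel run f refl
    ... | h , ρh≡ , run′ with ρ-inj ρh≡
    ... | refl = f , h , atᵢ′ , atⱼ′ , v , w , run′

  defined-relabel : defined (rename ρ P) ≡ map ρ (defined P)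
  defined-relabel = trans (sym (map-∘ (defs P))) (map-∘ (defs P))

  targets-relabel : ∀ D → concatMap (targets ∘ proj₂) (map relabelDef D)
                        ≡ map ρ (concatMap (targets ∘ proj₂) D)
  targets-relabel []                          = refl
  targets-relabel ((_ , jump g _) ∷ D)         = cong (ρ g ∷_) (targets-relabel D)
  targets-relabel ((_ , branch _ g _ h _) ∷ D) = cong (λ ls → ρ g ∷ ρ h ∷ ls) (targets-relabel D)

  labels-relabel : labels (rename ρ P) ≡ map ρ (labels P)
  labels-relabel = begin
    map ρ (entries P) ++ map ρ (exits P) ++ defined (rename ρ P) ++ concatMap (targets ∘ proj₂) (map relabelDef (defs P))
      ≡⟨ cong (λ ls → map ρ (entries P) ++ map ρ (exits P) ++ ls)
              (cong₂ _++_ defined-relabel (targets-relabel (defs P))) ⟩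
    map ρ (entries P) ++ map ρ (exits P) ++ map ρ (defined P) ++ map ρ (concatMap (targets ∘ proj₂) (defs P))
      ≡⟨ cong (λ ls → map ρ (entries P) ++ map ρ (exits P) ++ ls) (sym (map-++ ρ (defined P) _)) ⟩
    map ρ (entries P) ++ map ρ (exits P) ++ map ρ (defined P ++ concatMap (targets ∘ proj₂) (defs P))
      ≡⟨ cong (map ρ (entries P) ++_) (sym (map-++ ρ (exits P) _)) ⟩
    map ρ (entries P) ++ map ρ (exits P ++ defined P ++ concatMap (targets ∘ proj₂) (defs P))
      ≡⟨ sym (map-++ ρ (entries P) _) ⟩
    map ρ (labels P) ∎
    where open ≡-Reasoning

  exitsUndefined : ExitsUndefined P → ExitsUndefined (rename ρ P)
  exitsUndefined undef l l∈exits l∈defined with ∈-map⁻ ρ l∈exits | ∈-map⁻ proj₁ l∈defined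
  ... | f , f∈exits , refl | _ , fd′∈ , eq with ∈-map⁻ relabelDef fd′∈
  ... | fd , fd∈ , refl with ρ-inj eq
  ... | refl = undef f f∈exits (∈-map⁺ proj₁ fd∈)

glue : Program → Program → Program
glue P Q = prog (entries P) (defs P ++ defs Q) (exits Q)

module Glue (P Q : Program) (undef : ExitsUndefined P) (exits≡entries : exits P ≡ entries Q)
            (shared⇒exit : ∀ l → l ∈ labels P → l ∈ labels Q → l ∈ exits P) where

  step-split : ∀ {a b} → Step (glue P Q) a b → Step P a b ⊎ Step Q a b
  step-split (step-jump fd∈ r w) with ∈-++⁻ (defs P) fd∈
  ... | inj₁ fd∈P = inj₁ (step-jump fd∈P r w)
  ... | inj₂ fd∈Q = inj₂ (step-jump fd∈Q r w)
  step-split (step-inl fd∈ r r₁ w) with ∈-++⁻ (defs P) fd∈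
  ... | inj₁ fd∈P = inj₁ (step-inl fd∈P r r₁ w)
  ... | inj₂ fd∈Q = inj₂ (step-inl fd∈Q r r₁ w)
  step-split (step-inr fd∈ r r₂ w) with ∈-++⁻ (defs P) fd∈
  ... | inj₁ fd∈P = inj₁ (step-inr fd∈P r r₂ w)
  ... | inj₂ fd∈Q = inj₂ (step-inr fd∈Q r r₂ w)

  -- Once at a label of Q, a glued run never takes a step of P: such a step
  -- would leave from a shared label, i.e. an exit of P, which P does not define.
  run-stays-in-Q : ∀ {a b} → proj₁ a ∈ labels Q → Star (Step (glue P Q)) a b → Star (Step Q) a b
  run-stays-in-Q _    ε        = ε
  run-stays-in-Q a∈Q (s ◅ ss) with step-split s
  ... | inj₁ s′ = ⊥-elim (undef _ (shared⇒exit _ (defined∈labels P (step-source s′)) a∈Q) (step-source s′))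
  ... | inj₂ s′ = s′ ◅ run-stays-in-Q (step-target s′) ss

  run-split : ∀ {a b} → proj₁ a ∈ labels P → proj₁ b ∈ labels Q → Value (proj₂ a)
            → Star (Step (glue P Q)) a b
            → Σ[ h ∈ Label ] Σ[ u ∈ Exp 0 ] h ∈ exits P × Value u
                × Star (Step P) a (h , u) × Star (Step Q) (h , u) b
  run-split {f , v} f∈P b∈Q v-val run with f ∈? exits P
  ... | yes f∈exits =
    f , v , f∈exits , v-val , ε , run-stays-in-Q (entry∈labels Q (subst (f ∈_) exits≡entries f∈exits)) run
  run-split f∈P b∈Q v-val ε        | no f∉exits = ⊥-elim (f∉exits (shared⇒exit _ f∈P b∈Q))
  run-split f∈P b∈Q v-val (s ◅ ss) | no f∉exits with step-split s
  ... | inj₂ s′ = ⊥-elim (f∉exits (shared⇒exit _ f∈P (defined∈labels Q (step-source s′))))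
  ... | inj₁ s′ with run-split (step-target s′) b∈Q (step-value s′) ss
  ... | h , u , h∈exits , u-val , runP , runQ = h , u , h∈exits , u-val , s′ ◅ runP , runQ

  traces : ∀ {i v j w} → Trace (glue P Q) i v j w ⇔ SeqTrace P Q i v j w
  traces = mk⇔ split join
    where
    split : ∀ {i v j w} → Trace (glue P Q) i v j w → SeqTrace P Q i v j w
    split (f , k , atᵢ , atⱼ , v , w , run)
      with run-split (entry∈labels P (At⇒∈ atᵢ)) (exit∈labels Q (At⇒∈ atⱼ)) v run
    ... | h , u , h∈exits , u-val , runP , runQ with ∈⇒At h∈exits
    ... | l , atₗ = l , u , (f , h , atᵢ , atₗ , v , u-val , runP)
                          , (h , k , subst (λ ls → At ls l h) exits≡entries atₗ , atⱼ , u-val , w , runQ)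

    join : ∀ {i v j w} → SeqTrace P Q i v j w → Trace (glue P Q) i v j w
    join (l , u , (f , h , atᵢ , atₗ , v , _ , runP) , (g , k , atₗ′ , atⱼ , _ , w , runQ))
      with At-functional (subst (λ ls → At ls l h) exits≡entries atₗ) atₗ′
    ... | refl = f , k , atᵢ , atⱼ , v , w ,
                 Star.map (step-mono ∈-++⁺ˡ) runP ◅◅ Star.map (step-mono (∈-++⁺ʳ (defs P))) runQ

composite-traces : ∀ {P Q R} → ExitsUndefined P → Composite P Q R
                 → ∀ {i v j w} → Trace R i v j w ⇔ SeqTrace P Q i v j w
composite-traces {P} {Q} undef (ρ , σ , ρ-inj , σ-inj , exits≡entries , shared⇒exit , refl) =
  mk⇔ (SeqTrace-map (to RP.traces) (to RQ.traces) ∘ to G.traces)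
      (from G.traces ∘ SeqTrace-map (from RP.traces) (from RQ.traces))
  where
  module RP = Relabel ρ ρ-inj P
  module RQ = Relabel σ σ-inj Q
  module G = Glue (rename ρ P) (rename σ Q) (RP.exitsUndefined undef) exits≡entries shared⇒exit

-- A composite again has undefined exits (needed to compose it further).
composite-exitsUndefined : ∀ {P Q R} → ExitsUndefined P → ExitsUndefined Q → Composite P Q R
                         → ExitsUndefined R
composite-exitsUndefined {P} {Q} undefP undefQ (ρ , σ , ρ-inj , σ-inj , _ , shared⇒exit , refl) l l∈exits l∈defined
  with ∈-++⁻ (defined (rename ρ P)) (subst (l ∈_) (map-++ proj₁ (defs (rename ρ P)) (defs (rename σ Q))) l∈defined)
... | inj₁ l∈P = Relabel.exitsUndefined ρ ρ-inj P undefP l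
                   (shared⇒exit l (defined∈labels (rename ρ P) l∈P) (exit∈labels (rename σ Q) l∈exits)) l∈P
... | inj₂ l∈Q = Relabel.exitsUndefined σ σ-inj Q undefQ l l∈exits l∈Q

≈P-refl : ∀ {P} → P ≈P P
≈P-refl i v j w = id , id

≈P-sym : ∀ {P Q} → P ≈P Q → Q ≈P P
≈P-sym P≈Q i v j w = proj₂ (P≈Q i v j w) , proj₁ (P≈Q i v j w)

≈P-trans : ∀ {P Q R} → P ≈P Q → Q ≈P R → P ≈P R
≈P-trans P≈Q Q≈R i v j w = proj₁ (Q≈R i v j w) ∘ proj₁ (P≈Q i v j w)
                         , proj₂ (P≈Q i v j w) ∘ proj₂ (Q≈R i v j w)

typed-exitsUndefined : ∀ {P X Y} → P ∶ X ⇒ Y → ExitsUndefined P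
typed-exitsUndefined (wf , _) = WF.exits-undef wf

typed-lengths : ∀ {P X Y} → P ∶ X ⇒ Y → length (entries P) ≡ length X × length (exits P) ≡ length Y
typed-lengths {P} (_ , A , _ , refl , refl) = sym (length-map A (entries P)) , sym (length-map A (exits P))

idP-trace : ∀ {X l u j w} → Trace (idP X) l u j w → l ≡ j × u ≡ w
idP-trace {X} (_ , _ , atₗ , atⱼ , _ , _ , ε) =
  trans (sym (At-applyUpTo⁻ id (length X) atₗ)) (At-applyUpTo⁻ id (length X) atⱼ) , refl
idP-trace (_ , _ , _ , _ , _ , _ , step-jump () _ _  ◅ _)
idP-trace (_ , _ , _ , _ , _ , _ , step-inl () _ _ _ ◅ _)
idP-trace (_ , _ , _ , _ , _ , _ , step-inr () _ _ _ ◅ _)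

idP-trace⁺ : ∀ {X l u} → l < length X → Value u → Trace (idP X) l u l u
idP-trace⁺ {X} {l} l<n u = l , l , At-applyUpTo⁺ id (length X) l<n , At-applyUpTo⁺ id (length X) l<n , u , u , ε

idP-exitsUndefined : ∀ X → ExitsUndefined (idP X)
idP-exitsUndefined X l _ ()

identityˡ : ∀ {X Y P R} → P ∶ X ⇒ Y → Composite P (idP Y) R → R ≈P P
identityˡ {Y = Y} {P} {R} P-typed c i v j w = drop-id ∘ to traces , from traces ∘ add-id
  where
  traces : Trace R i v j w ⇔ SeqTrace P (idP Y) i v j w
  traces = composite-traces (typed-exitsUndefined P-typed) c

  drop-id : SeqTrace P (idP Y) i v j w → Trace P i v j w
  drop-id (l , u , t , t-id) with idP-trace {Y} t-id
  ... | refl , refl = t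

  add-id : Trace P i v j w → SeqTrace P (idP Y) i v j w
  add-id t = j , w , t , idP-trace⁺ {Y} (subst (j <_) (proj₂ (typed-lengths P-typed)) (trace-exit-bound t))
                                        (proj₂ (trace-values t))

identityʳ : ∀ {X Y P R} → P ∶ X ⇒ Y → Composite (idP X) P R → R ≈P P
identityʳ {X} {P = P} {R} P-typed c i v j w = drop-id ∘ to traces , from traces ∘ add-id
  where
  traces : Trace R i v j w ⇔ SeqTrace (idP X) P i v j w
  traces = composite-traces (idP-exitsUndefined X) c

  drop-id : SeqTrace (idP X) P i v j w → Trace P i v j w
  drop-id (l , u , t-id , t) with idP-trace {X} t-id
  ... | refl , refl = t

  add-id : Trace P i v j w → SeqTrace (idP X) P i v j w
  add-id t = i , v , idP-trace⁺ {X} (subst (i <_) (proj₁ (typed-lengths P-typed)) (trace-entry-bound t))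
                                    (proj₁ (trace-values t)) , t

comp-cong : ∀ {X Y Z P P′ Q Q′ R R′}
          → P ∶ X ⇒ Y → P′ ∶ X ⇒ Y → Q ∶ Y ⇒ Z → Q′ ∶ Y ⇒ Z
          → P ≈P P′ → Q ≈P Q′ → Composite P Q R → Composite P′ Q′ R′ → R ≈P R′
comp-cong {P = P} {P′} {Q} {Q′} {R} {R′} P-typed P′-typed _ _ P≈P′ Q≈Q′ c c′ i v j w =
    from traces′ ∘ SeqTrace-map (proj₁ (P≈P′ _ _ _ _)) (proj₁ (Q≈Q′ _ _ _ _)) ∘ to traces
  , from traces ∘ SeqTrace-map (proj₂ (P≈P′ _ _ _ _)) (proj₂ (Q≈Q′ _ _ _ _)) ∘ to traces′
  where
  traces : Trace R i v j w ⇔ SeqTrace P Q i v j w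
  traces = composite-traces (typed-exitsUndefined P-typed) c
  traces′ : Trace R′ i v j w ⇔ SeqTrace P′ Q′ i v j w
  traces′ = composite-traces (typed-exitsUndefined P′-typed) c′

-- Associativity: both bracketings have the traces of P, then Q, then S.
assoc : ∀ {W X Y Z P Q S PQ QS A B}
      → P ∶ W ⇒ X → Q ∶ X ⇒ Y → S ∶ Y ⇒ Z
      → Composite P Q PQ → Composite PQ S A → Composite Q S QS → Composite P QS B
      → A ≈P B
assoc {P = P} {Q} {S} {PQ} {QS} {A} {B} P-typed Q-typed _ cPQ cA cQS cB i v j w =
  from P[QS] ∘ reassociateʳ ∘ to [PQ]S , from [PQ]S ∘ reassociateˡ ∘ to P[QS]
  where
  undefP : ExitsUndefined P
  undefP = typed-exitsUndefined P-typed
  undefQ : ExitsUndefined Q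
  undefQ = typed-exitsUndefined Q-typed

  tracesPQ : ∀ {i v j w} → Trace PQ i v j w ⇔ SeqTrace P Q i v j w
  tracesPQ = composite-traces undefP cPQ
  tracesQS : ∀ {i v j w} → Trace QS i v j w ⇔ SeqTrace Q S i v j w
  tracesQS = composite-traces undefQ cQS
  [PQ]S : Trace A i v j w ⇔ SeqTrace PQ S i v j w
  [PQ]S = composite-traces (composite-exitsUndefined undefP undefQ cPQ) cA
  P[QS] : Trace B i v j w ⇔ SeqTrace P QS i v j w
  P[QS] = composite-traces undefP cB

  reassociateʳ : SeqTrace PQ S i v j w → SeqTrace P QS i v j w
  reassociateʳ (m , u′ , tPQ , tS) with to tracesPQ tPQ
  ... | l , u , tP , tQ = l , u , tP , from tracesQS (m , u′ , tQ , tS)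

  reassociateˡ : SeqTrace P QS i v j w → SeqTrace PQ S i v j w
  reassociateˡ (l , u , tP , tQS) with to tracesQS tQS
  ... | m , u′ , tQ , tS = m , u′ , from tracesPQ (l , u , tP , tQ) , tS

-- Identities are well typed: label k gets the k-th type of X.

nth : List (Ty 0) → ℕ → Ty 0
nth []      _       = unit
nth (A ∷ X) zero    = A
nth (A ∷ X) (suc k) = nth X k

tabulate-nth : ∀ X → applyUpTo (nth X) (length X) ≡ X
tabulate-nth []      = refl
tabulate-nth (A ∷ X) = cong (A ∷_) (tabulate-nth X)

idP-typed : ∀ X → idP X ∶ X ⇒ X
idP-typed X = wf , nth X , (λ _ _ ()) , labels-typed , labels-typed
  where
  wf : WF (idP X)
  wf = record { entries-unique = Unique.upTo⁺ (length X)
              ; exits-unique   = Unique.upTo⁺ (length X)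
              ; defs-unique    = []
              ; exits-undef    = idP-exitsUndefined X }
  labels-typed : map (nth X) (upTo (length X)) ≡ X
  labels-typed = trans (map-applyUpTo id (nth X) (length X)) (tabulate-nth X)

-- A left inverse of an injective map on a given finite list of arguments.
preimage : (Label → Label) → List Label → Label → Label
preimage ρ []       _ = zero
preimage ρ (f ∷ fs) l with ρ f ≟ l
... | yes _ = f
... | no  _ = preimage ρ fs l

preimage-inverse : ∀ ρ → Injective _≡_ _≡_ ρ → ∀ {f fs} → f ∈ fs → preimage ρ fs (ρ f) ≡ f
preimage-inverse ρ ρ-inj {f} {g ∷ gs} f∈ with ρ g ≟ ρ f
... | yes ρg≡ρf = ρ-inj ρg≡ρf
preimage-inverse ρ ρ-inj (here refl) | no ρg≢ρf = ⊥-elim (ρg≢ρf refl)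
preimage-inverse ρ ρ-inj (there f∈) | no _      = preimage-inverse ρ ρ-inj f∈

DefOK-relabel : ∀ ρ (A A′ : Label → Ty 0) f d → (∀ l → l ∈ f ∷ targets d → A′ (ρ l) ≡ A l)
              → DefOK A f d → DefOK A′ (ρ f) (renDef ρ d)
DefOK-relabel ρ A A′ f (jump g e) keeps ⊢e =
  subst₂ (λ B C → (B ∷ []) ⊢ e ∶ C) (sym (keeps f (here refl))) (sym (keeps g (there (here refl)))) ⊢e
DefOK-relabel ρ A A′ f (branch e g e₁ h e₂) keeps (C₁ , C₂ , ⊢e , ⊢e₁ , ⊢e₂) =
  C₁ , C₂ , subst (λ B → (B ∷ []) ⊢ e ∶ (C₁ ⊕ C₂)) (sym (keeps f (here refl))) ⊢e
          , subst (λ B → (C₁ ∷ []) ⊢ e₁ ∶ B) (sym (keeps g (there (here refl)))) ⊢e₁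
          , subst (λ B → (C₂ ∷ []) ⊢ e₂ ∶ B) (sym (keeps h (there (there (here refl))))) ⊢e₂

-- The typing of a composite: a label of the renamed P gets its type in P,
-- every other label its type in Q; on the shared labels the two agree
-- because the types of P's exits are those of Q's entries.
module CompositeTyping {P Q : Program} (AP AQ : Label → Ty 0)
                       (P-defs-typed : ∀ f d → (f , d) ∈ defs P → DefOK AP f d)
                       (Q-defs-typed : ∀ f d → (f , d) ∈ defs Q → DefOK AQ f d)
                       (exits≡entries-typed : map AP (exits P) ≡ map AQ (entries Q))
                       (ρ σ : Label → Label) (ρ-inj : Injective _≡_ _≡_ ρ) (σ-inj : Injective _≡_ _≡_ σ)
                       (exits≡entries : exits (rename ρ P) ≡ entries (rename σ Q))
                       (shared⇒exit : ∀ l → l ∈ labels (rename ρ P) → l ∈ labels (rename σ Q)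
                                          → l ∈ exits (rename ρ P)) where
  private
    module RP = Relabel ρ ρ-inj P
    module RQ = Relabel σ σ-inj Q

  A : Label → Ty 0
  A l with l ∈? labels (rename ρ P)
  ... | yes _ = AP (preimage ρ (labels P) l)
  ... | no  _ = AQ (preimage σ (labels Q) l)

  A-on-P : ∀ f → f ∈ labels P → A (ρ f) ≡ AP f
  A-on-P f f∈ with ρ f ∈? labels (rename ρ P)
  ... | yes _   = cong AP (preimage-inverse ρ ρ-inj f∈)
  ... | no ρf∉ = ⊥-elim (ρf∉ (subst (ρ f ∈_) (sym RP.labels-relabel) (∈-map⁺ ρ f∈)))

  exit-entry-type : ∀ {h g} → h ∈ exits P → ρ h ≡ σ g → AP h ≡ AQ g
  exit-entry-type {h} h∈ ρh≡σg with ∈⇒At h∈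
  ... | k , atₖ with At-map⁻ σ (subst (λ ls → At ls k (ρ h)) exits≡entries (At-map⁺ ρ atₖ))
  ... | g′ , atₖ′ , σg′≡ρh with σ-inj (trans σg′≡ρh ρh≡σg)
  ... | refl = At-functional (subst (λ Ts → At Ts k (AP h)) exits≡entries-typed (At-map⁺ AP atₖ)) (At-map⁺ AQ atₖ′)

  A-on-Q : ∀ g → g ∈ labels Q → A (σ g) ≡ AQ g
  A-on-Q g g∈ with σ g ∈? labels (rename ρ P)
  ... | no _      = cong AQ (preimage-inverse σ σ-inj g∈)
  ... | yes σg∈P with ∈-map⁻ ρ (shared⇒exit (σ g) σg∈P (subst (σ g ∈_) (sym RQ.labels-relabel) (∈-map⁺ σ g∈)))
  ... | h , h∈exits , σg≡ρh = begin
    AP (preimage ρ (labels P) (σ g)) ≡⟨ cong (AP ∘ preimage ρ (labels P)) σg≡ρh ⟩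
    AP (preimage ρ (labels P) (ρ h)) ≡⟨ cong AP (preimage-inverse ρ ρ-inj (exit∈labels P h∈exits)) ⟩
    AP h                             ≡⟨ exit-entry-type h∈exits (sym σg≡ρh) ⟩
    AQ g                             ∎
    where open ≡-Reasoning

  mentioned-typed : ∀ R {τ : Label → Label} {AR : Label → Ty 0} → (∀ l → l ∈ labels R → A (τ l) ≡ AR l)
                  → ∀ {f d} → (f , d) ∈ defs R → ∀ l → l ∈ f ∷ targets d → A (τ l) ≡ AR l
  mentioned-typed R typed fd∈ l (here refl) = typed l (defined∈labels R (∈-map⁺ proj₁ fd∈))
  mentioned-typed R typed fd∈ l (there l∈)  = typed l (target∈labels R fd∈ l∈)

  definitions-typed : ∀ f d → (f , d) ∈ defs (glue (rename ρ P) (rename σ Q)) → DefOK A f d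
  definitions-typed f d fd∈ with ∈-++⁻ (defs (rename ρ P)) fd∈
  ... | inj₁ fd∈P with ∈-map⁻ RP.relabelDef fd∈P
  ...   | (f₀ , d₀) , fd₀∈ , refl =
          DefOK-relabel ρ AP A f₀ d₀ (mentioned-typed P A-on-P fd₀∈) (P-defs-typed f₀ d₀ fd₀∈)
  definitions-typed f d fd∈ | inj₂ fd∈Q with ∈-map⁻ RQ.relabelDef fd∈Q
  ...   | (f₀ , d₀) , fd₀∈ , refl =
          DefOK-relabel σ AQ A f₀ d₀ (mentioned-typed Q A-on-Q fd₀∈) (Q-defs-typed f₀ d₀ fd₀∈)

  relabelled-types : ∀ R {τ : Label → Label} {AR : Label → Ty 0} → (∀ l → l ∈ labels R → A (τ l) ≡ AR l)
                   → ∀ {ls} → (∀ {l} → l ∈ ls → l ∈ labels R) → map A (map τ ls) ≡ map AR ls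
  relabelled-types R typed {ls} ls⊆R =
    trans (sym (map-∘ ls)) (map-cong-local (All.tabulate (λ {l} l∈ → typed l (ls⊆R l∈))))

  entries-typed : map A (entries (rename ρ P)) ≡ map AP (entries P)
  entries-typed = relabelled-types P A-on-P (entry∈labels P)

  exits-typed : map A (exits (rename σ Q)) ≡ map AQ (exits Q)
  exits-typed = relabelled-types Q A-on-Q (exit∈labels Q)

composite-wf : ∀ {P Q R} → WF P → WF Q → Composite P Q R → WF R
composite-wf {P} {Q} wfP wfQ c@(ρ , σ , ρ-inj , σ-inj , _ , shared⇒exit , refl) = record
  { entries-unique = Unique.map⁺ ρ-inj (WF.entries-unique wfP)
  ; exits-unique   = Unique.map⁺ σ-inj (WF.exits-unique wfQ)
  ; defs-unique    = subst Unique (sym (map-++ proj₁ (defs (rename ρ P)) (defs (rename σ Q))))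
                           (Unique.++⁺ (unique-relabel ρ ρ-inj P wfP) (unique-relabel σ σ-inj Q wfQ) disjoint)
  ; exits-undef    = composite-exitsUndefined (WF.exits-undef wfP) (WF.exits-undef wfQ) c
  }
  where
  unique-relabel : ∀ τ (τ-inj : Injective _≡_ _≡_ τ) R → WF R → Unique (defined (rename τ R))
  unique-relabel τ τ-inj R wfR =
    subst Unique (sym (Relabel.defined-relabel τ τ-inj R)) (Unique.map⁺ τ-inj (WF.defs-unique wfR))

  -- a label defined in both would be shared, hence an exit of P
  disjoint : ∀ {l} → l ∈ defined (rename ρ P) × l ∈ defined (rename σ Q) → ⊥
  disjoint {l} (l∈P , l∈Q) =
    Relabel.exitsUndefined ρ ρ-inj P (WF.exits-undef wfP) l
      (shared⇒exit l (defined∈labels (rename ρ P) l∈P) (defined∈labels (rename σ Q) l∈Q)) l∈P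

composite-typed : ∀ {X Y Z P Q R} → P ∶ X ⇒ Y → Q ∶ Y ⇒ Z → Composite P Q R → R ∶ X ⇒ Z
composite-typed {P = P} {Q} (wfP , AP , P-defs , refl , exits-typedP) (wfQ , AQ , Q-defs , entries-typedQ , refl)
                c@(ρ , σ , ρ-inj , σ-inj , exits≡entries , shared⇒exit , refl) =
  composite-wf wfP wfQ c , T.A , T.definitions-typed , T.entries-typed , T.exits-typed
  where
  module T = CompositeTyping {P} {Q} AP AQ P-defs Q-defs (trans exits-typedP (sym entries-typedQ))
                             ρ σ ρ-inj σ-inj exits≡entries shared⇒exit

-- Composites exist.  ℕ is split into three disjoint infinite parts
-- 3k, 3k+1, 3k+2.  P's k-th exit and Q's k-th entry both go to 3k; every
-- other label l goes to 3l+1 in P and to 3l+2 in Q.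

triple : ℕ → ℕ
triple zero    = zero
triple (suc n) = suc (suc (suc (triple n)))

triple-injective : Injective _≡_ _≡_ triple
triple-injective {zero}  {zero}  _  = refl
triple-injective {suc a} {suc b} eq = cong suc (triple-injective (suc-injective (suc-injective (suc-injective eq))))

triple≢1+triple : ∀ a b → triple a ≢ suc (triple b)
triple≢1+triple (suc a) (suc b) eq = triple≢1+triple a b (suc-injective (suc-injective (suc-injective eq)))

triple≢2+triple : ∀ a b → triple a ≢ suc (suc (triple b))
triple≢2+triple (suc a) b eq = triple≢1+triple b a (sym (suc-injective (suc-injective eq)))

encode : (ℕ → ℕ) → ∀ {ls : List Label} l → Dec (l ∈ ls) → Label
encode off l (yes l∈) = triple (proj₁ (∈⇒At l∈))
encode off l (no _)   = off (triple l)

code : (ℕ → ℕ) → List Label → Label → Label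
code off ls l = encode off l (l ∈? ls)

code-injective : ∀ off ls → Injective _≡_ _≡_ off → (∀ a b → triple a ≢ off (triple b))
               → Injective _≡_ _≡_ (code off ls)
code-injective off ls off-inj apart {a} {b} eq with a ∈? ls | b ∈? ls
... | yes a∈ | yes b∈ = At-functional (proj₂ (∈⇒At a∈))
                          (subst (λ k → At ls k b) (sym (triple-injective eq)) (proj₂ (∈⇒At b∈)))
... | yes _  | no _   = ⊥-elim (apart _ b eq)
... | no _   | yes _  = ⊥-elim (apart _ a (sym eq))
... | no _   | no _   = triple-injective (off-inj eq)

code-position : ∀ off {ls k l} → Unique ls → At ls k l → code off ls l ≡ triple k
code-position off {ls} {l = l} u atₖ with l ∈? ls
... | yes l∈ = cong triple (At-position-unique u (proj₂ (∈⇒At l∈)) atₖ)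
... | no l∉  = ⊥-elim (l∉ (At⇒∈ atₖ))

code-list : ∀ off ls → Unique ls → map (code off ls) ls ≡ applyUpTo triple (length ls)
code-list off ls u = map-by-position (code off ls) triple ls (λ k l atₖ → code-position off u atₖ)

renameP : List Label → Label → Label
renameP = code suc

renameQ : List Label → Label → Label
renameQ = code (suc ∘ suc)

renameP-injective : ∀ ls → Injective _≡_ _≡_ (renameP ls)
renameP-injective ls = code-injective suc ls suc-injective triple≢1+triple

renameQ-injective : ∀ ls → Injective _≡_ _≡_ (renameQ ls)
renameQ-injective ls = code-injective (suc ∘ suc) ls (suc-injective ∘ suc-injective) triple≢2+triple

renamings-meet : ∀ ls ms {a b} → renameP ls a ≡ renameQ ms b → a ∈ ls
renamings-meet ls ms {a} {b} eq with a ∈? ls | b ∈? ms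
... | yes a∈ | _     = a∈
... | no _   | yes _ = ⊥-elim (triple≢1+triple _ a (sym eq))
... | no _   | no _  = ⊥-elim (triple≢1+triple a b (suc-injective eq))

composite-exists : ∀ {X Y Z P Q} → P ∶ X ⇒ Y → Q ∶ Y ⇒ Z → Σ[ R ∈ Program ] Composite P Q R
composite-exists {Y = Y} {P = P} {Q} P-typed Q-typed =
  _ , ρ , σ , renameP-injective (exits P) , renameQ-injective (entries Q) , exits≡entries , shared⇒exit , refl
  where
  ρ σ : Label → Label
  ρ = renameP (exits P)
  σ = renameQ (entries Q)

  exits≡entries : map ρ (exits P) ≡ map σ (entries Q)
  exits≡entries = begin
    map ρ (exits P)                         ≡⟨ code-list suc (exits P) (WF.exits-unique (proj₁ P-typed)) ⟩
    applyUpTo triple (length (exits P))     ≡⟨ cong (applyUpTo triple) (proj₂ (typed-lengths P-typed)) ⟩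
    applyUpTo triple (length Y)             ≡⟨ cong (applyUpTo triple) (sym (proj₁ (typed-lengths Q-typed))) ⟩
    applyUpTo triple (length (entries Q))   ≡⟨ sym (code-list (suc ∘ suc) (entries Q) (WF.entries-unique (proj₁ Q-typed))) ⟩
    map σ (entries Q)                       ∎
    where open ≡-Reasoning

  shared⇒exit : ∀ l → l ∈ labels (rename ρ P) → l ∈ labels (rename σ Q) → l ∈ map ρ (exits P)
  shared⇒exit l l∈P l∈Q
    with ∈-map⁻ ρ (subst (l ∈_) (Relabel.labels-relabel ρ (renameP-injective (exits P)) P) l∈P)
       | ∈-map⁻ σ (subst (l ∈_) (Relabel.labels-relabel σ (renameQ-injective (entries Q)) Q) l∈Q)
  ... | a , _ , refl | b , _ , ρa≡σb = ∈-map⁺ ρ (renamings-meet (exits P) (entries Q) ρa≡σb)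

lemma2p5 : TIsCategory
lemma2p5 = record
  { ≈-refl      = ≈P-refl
  ; ≈-sym       = ≈P-sym
  ; ≈-trans     = ≈P-trans
  ; id-typed    = idP-typed
  ; comp-exists = composite-exists
  ; comp-typed  = composite-typed
  ; comp-cong   = comp-cong
  ; identityˡ   = identityˡ
  ; identityʳ   = identityʳ
  ; assoc       = assoc
  }
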